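{- Let $\mathbb{F}$ be a field of characteristic $0$ and let $f:\mathbb{F}^n\to\mathbb{F}^m$ be a polynomial mapping which is $(s,1)$-weakly elusive and not $(s+1,1)$-weakly elusive, i.e. the linear span of $f(\mathbb{F}^n)$ is a linear subspace $V\cong\mathbb{F}^{s+1}$ of $\mathbb{F}^m$. Let $\pi:\mathbb{F}^m\to\mathbb{F}^{s+1}$ be a (linear) projection onto $V\cong\mathbb{F}^{s+1}$. Then for all integers $l,r\ge1$, $f$ is $(l,r)$-weakly elusive if and only if $\pi\circ f:\mathbb{F}^n\to\mathbb{F}^{s+1}$ is $(l,r)$-weakly elusive.
   Context: A polynomial mapping $g:\mathbb{F}^a\to\mathbb{F}^b$ is $(l,r)$-weakly elusive if its image is not contained in the image of any homogeneous polynomial mapping $\Gamma:\mathbb{F}^l\to\mathbb{F}^b$ of degree $r$ (each component homogeneous of degree $r$). -}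

module Defs where

open import Level using (Level; _⊔_)
open import Algebra.Bundles using (CommutativeRing)
open import Data.Nat using (ℕ; zero; suc) renaming (_+_ to _+ℕ_)
open import Data.Fin using (Fin; zero; suc)
open import Data.Product using (Σ; ∃; _×_; _,_)
open import Relation.Nullary using (¬_)

record Field (c ℓ : Level) : Set (Level.suc (c ⊔ ℓ)) where
  field
    commRing : CommutativeRing c ℓ
  open CommutativeRing commRing public
  field
    1≉0     : ¬ (1# ≈ 0#)
    inverse : ∀ x → ¬ (x ≈ 0#) → ∃ λ y → (x * y) ≈ 1#

module FieldDefs {c ℓ : Level} (F : Field c ℓ) where
  open Field F using (Carrier; _≈_; _+_; _*_; 0#; 1#)

  natCast : ℕ → Carrier
  natCast zero    = 0#
  natCast (suc k) = 1# + natCast k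

  CharZero : Set ℓ
  CharZero = ∀ k → ¬ (natCast (suc k) ≈ 0#)

  Vect : ℕ → Set c
  Vect k = Fin k → Carrier

  sumF : ∀ {k} → (Fin k → Carrier) → Carrier
  sumF {zero}  v = 0#
  sumF {suc k} v = v zero + sumF (λ i → v (suc i))

  _≋_ : ∀ {k} → Vect k → Vect k → Set ℓ
  u ≋ v = ∀ i → u i ≈ v i

  data Poly (k : ℕ) : Set c where
    const : Carrier → Poly k
    var   : Fin k → Poly k
    _⊕_   : Poly k → Poly k → Poly k
    _⊗_   : Poly k → Poly k → Poly k

  eval : ∀ {k} → Poly k → Vect k → Carrier
  eval (const a) x = a
  eval (var i)   x = x i
  eval (p ⊕ q)   x = eval p x + eval q x
  eval (p ⊗ q)   x = eval p x * eval q x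

  -- These generate exactly the homogeneous
  -- polynomials of degree d (including 0).
  data HPoly (k : ℕ) : ℕ → Set c where
    hconst : Carrier → HPoly k 0
    hvar   : Fin k → HPoly k 1
    _h⊕_   : ∀ {d} → HPoly k d → HPoly k d → HPoly k d
    _h⊗_   : ∀ {d e} → HPoly k d → HPoly k e → HPoly k (d +ℕ e)

  heval : ∀ {k d} → HPoly k d → Vect k → Carrier
  heval (hconst a) x = a
  heval (hvar i)   x = x i
  heval (p h⊕ q)   x = heval p x + heval q x
  heval (p h⊗ q)   x = heval p x * heval q x

  PolyMap : ℕ → ℕ → Set c
  PolyMap a b = Fin b → Poly a

  ⟦_⟧ : ∀ {a b} → PolyMap a b → Vect a → Vect b
  ⟦ f ⟧ x j = eval (f j) x

  HomPolyMap : ℕ → ℕ → ℕ → Set c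
  HomPolyMap l r b = Fin b → HPoly l r

  ⟦_⟧ₕ : ∀ {l r b} → HomPolyMap l r b → Vect l → Vect b
  ⟦ Γ ⟧ₕ y j = heval (Γ j) y

  ImageSub : ∀ {a a' b} → (Vect a → Vect b) → (Vect a' → Vect b) → Set (c ⊔ ℓ)
  ImageSub g h = ∀ x → ∃ λ y → g x ≋ h y

  WeaklyElusive : ∀ {a b} → ℕ → ℕ → (Vect a → Vect b) → Set (c ⊔ ℓ)
  WeaklyElusive {a} {b} l r g =
    ¬ (∃ λ (Γ : HomPolyMap l r b) → ImageSub g ⟦ Γ ⟧ₕ)

  Matrix : ℕ → ℕ → Set c
  Matrix k m = Fin k → Fin m → Carrier

  linMap : ∀ {k m} → Matrix k m → Vect m → Vect k
  linMap A v i = sumF (λ j → A i j * v j)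

  InSpanImage : ∀ {a b} → (Vect a → Vect b) → Vect b → Set (c ⊔ ℓ)
  InSpanImage {a} {b} g v =
    ∃ λ (k : ℕ) → ∃ λ (pts : Fin k → Vect a) → ∃ λ (coef : Fin k → Carrier) →
      v ≋ (λ j → sumF (λ t → coef t * g (pts t) j))

  IsoOnSpanImage : ∀ {a b k} → Matrix k b → (Vect a → Vect b) → Set (c ⊔ ℓ)
  IsoOnSpanImage {a} {b} {k} A g =
    (∀ u v → InSpanImage g u → InSpanImage g v → linMap A u ≋ linMap A v → u ≋ v)
    × (∀ w → ∃ λ v → InSpanImage g v × linMap A v ≋ w)

-- The hypotheses give a linear map σ : F^{s+1} → F^m with σ ∘ π = id on the
-- span of the image of f, so f = σ ∘ (π ∘ f) and π ∘ f are each a linear image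
-- of the other.  A linear image of a homogeneous map of degree r is again one
-- (apply the matrix to its components), so a covering of either map by a
-- homogeneous Γ yields one of the other.
module Submission where

open import Defs
open import Level using (Level)
open import Algebra.Bundles using (Monoid)
import Algebra.Properties.CommutativeSemigroup as CommutativeSemigroupProperties
open import Data.Nat using (ℕ; suc; _≥_) renaming (zero to nzero; _+_ to _+ℕ_)
open import Data.Fin using (Fin; zero; suc; splitAt)
open import Data.Sum using (inj₁; inj₂)
open import Data.Product using (_,_; proj₁; proj₂)
open import Data.Vec.Functional using (Vector; _++_; zipWith)
open import Function using (_∘_; _⇔_; mk⇔)
open import Relation.Nullary using (¬_)
open import Relation.Binary.PropositionalEquality as ≡ using (_≡_; _≗_)

tail-++ : ∀ {a} {A : Set a} {m n} (xs : Vector A (suc m)) (ys : Vector A n) →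
  (xs ++ ys) ∘ suc ≗ (xs ∘ suc) ++ ys
tail-++ {m = m} xs ys i with splitAt m i
... | inj₁ _ = ≡.refl
... | inj₂ _ = ≡.refl

zipWith-++ : ∀ {a b c} {A : Set a} {B : Set b} {C : Set c} {m n} (f : A → B → C)
  (xs : Vector A m) (ys : Vector A n) (xs′ : Vector B m) (ys′ : Vector B n) →
  zipWith f (xs ++ ys) (xs′ ++ ys′) ≗ zipWith f xs xs′ ++ zipWith f ys ys′
zipWith-++ {m = m} f xs ys xs′ ys′ i with splitAt m i
... | inj₁ _ = ≡.refl
... | inj₂ _ = ≡.refl

module _ {c ℓ} (M : Monoid c ℓ) where
  open Monoid M
  open import Algebra.Properties.Monoid.Sum M

  sum-++ : ∀ {m n} (xs : Vector Carrier m) (ys : Vector Carrier n) →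
    sum (xs ++ ys) ≈ sum xs ∙ sum ys
  sum-++ {nzero} xs ys = sym (identityˡ _)
  sum-++ {suc m} xs ys = begin
    xs zero ∙ sum ((xs ++ ys) ∘ suc)     ≡⟨ ≡.cong (xs zero ∙_) (sum-cong-≗ (tail-++ xs ys)) ⟩
    xs zero ∙ sum ((xs ∘ suc) ++ ys)     ≈⟨ ∙-congˡ (sum-++ (xs ∘ suc) ys) ⟩
    xs zero ∙ (sum (xs ∘ suc) ∙ sum ys)  ≈⟨ assoc _ _ _ ⟨
    sum xs ∙ sum ys                      ∎
    where open import Relation.Binary.Reasoning.Setoid setoid

module _ {c ℓ : Level} (F : Field c ℓ) where
  open Field F hiding (zero)
  open FieldDefs F
  open import Algebra.Properties.Semiring.Sum semiring
    using (sum; sum-cong-≋; sum-replicate-zero; ∑-comm; *-distribˡ-sum; *-distribʳ-sum)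

  sumF≡sum : ∀ {k} (v : Vect k) → sumF v ≡ sum v
  sumF≡sum {nzero} v = ≡.refl
  sumF≡sum {suc k} v = ≡.cong (v zero +_) (sumF≡sum (v ∘ suc))

  private
    sumF≈sum : ∀ {k} (v : Vect k) → sumF v ≈ sum v
    sumF≈sum v = reflexive (sumF≡sum v)

  sumF-cong : ∀ {k} {u v : Vect k} → u ≋ v → sumF u ≈ sumF v
  sumF-cong {u = u} {v} u≋v = trans (sumF≈sum u) (trans (sum-cong-≋ u≋v) (sym (sumF≈sum v)))

  sumF-zero : ∀ k → sumF {k} (λ _ → 0#) ≈ 0#
  sumF-zero k = trans (sumF≈sum {k} (λ _ → 0#)) (sum-replicate-zero k)

  sumF-*ˡ : ∀ {k} a (u : Vect k) → a * sumF u ≈ sumF (λ t → a * u t)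
  sumF-*ˡ a u = trans (*-congˡ (sumF≈sum u)) (trans (*-distribˡ-sum a u) (sym (sumF≈sum (λ t → a * u t))))

  sumF-*ʳ : ∀ {k} a (u : Vect k) → sumF u * a ≈ sumF (λ t → u t * a)
  sumF-*ʳ a u = trans (*-congʳ (sumF≈sum u)) (trans (*-distribʳ-sum a u) (sym (sumF≈sum (λ t → u t * a))))

  sumF-comm : ∀ {k k′} (M : Fin k → Fin k′ → Carrier) →
    sumF (λ i → sumF (λ j → M i j)) ≈ sumF (λ j → sumF (λ i → M i j))
  sumF-comm M = begin
    sumF (λ i → sumF (M i))          ≈⟨ sumF-cong (λ i → sumF≈sum (M i)) ⟩
    sumF (λ i → sum (M i))           ≈⟨ sumF≈sum (λ i → sum (M i)) ⟩
    sum (λ i → sum (M i))            ≈⟨ ∑-comm M ⟩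
    sum (λ j → sum (λ i → M i j))    ≈⟨ sumF≈sum (λ j → sum (λ i → M i j)) ⟨
    sumF (λ j → sum (λ i → M i j))   ≈⟨ sumF-cong (λ j → sumF≈sum (λ i → M i j)) ⟨
    sumF (λ j → sumF (λ i → M i j))  ∎
    where open import Relation.Binary.Reasoning.Setoid setoid

  sumF-++ : ∀ {k k′} (u : Vect k) (v : Vect k′) → sumF (u ++ v) ≈ sumF u + sumF v
  sumF-++ u v = trans (sumF≈sum (u ++ v)) (trans (sum-++ +-monoid u v) (sym (+-cong (sumF≈sum u) (sumF≈sum v))))

  1ᴹ : ∀ {k} → Matrix k k
  1ᴹ zero    zero    = 1#
  1ᴹ zero    (suc _) = 0#
  1ᴹ (suc _) zero    = 0#
  1ᴹ (suc i) (suc j) = 1ᴹ i j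

  1ᴹ-sym : ∀ {k} (i j : Fin k) → 1ᴹ i j ≡ 1ᴹ j i
  1ᴹ-sym zero    zero    = ≡.refl
  1ᴹ-sym zero    (suc _) = ≡.refl
  1ᴹ-sym (suc _) zero    = ≡.refl
  1ᴹ-sym (suc i) (suc j) = 1ᴹ-sym i j

  _·ᴹ_ : ∀ {k m n} → Matrix k m → Matrix m n → Matrix k n
  (A ·ᴹ B) i t = sumF (λ j → A i j * B j t)

  linMap-cong : ∀ {k m} (A : Matrix k m) {u v : Vect m} → u ≋ v → linMap A u ≋ linMap A v
  linMap-cong A u≋v i = sumF-cong (λ j → *-congˡ (u≋v j))

  linMap-congᴹ : ∀ {k m} {A B : Matrix k m} → (∀ i j → A i j ≈ B i j) →
    ∀ v → linMap A v ≋ linMap B v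
  linMap-congᴹ A≈B v i = sumF-cong (λ j → *-congʳ (A≈B i j))

  linMap-1ᴹ : ∀ {k} (v : Vect k) → linMap 1ᴹ v ≋ v
  linMap-1ᴹ {suc k} v zero =
    trans (+-cong (*-identityˡ _) (trans (sumF-cong (λ t → zeroˡ (v (suc t)))) (sumF-zero k)))
          (+-identityʳ _)
  linMap-1ᴹ {suc k} v (suc i) = trans (+-cong (zeroˡ _) (linMap-1ᴹ (v ∘ suc) i)) (+-identityˡ _)

  linMap-·ᴹ : ∀ {k m n} (A : Matrix k m) (B : Matrix m n) v →
    linMap A (linMap B v) ≋ linMap (A ·ᴹ B) v
  linMap-·ᴹ A B v i = begin
    sumF (λ j → A i j * sumF (λ t → B j t * v t))      ≈⟨ sumF-cong (λ j → sumF-*ˡ (A i j) (λ t → B j t * v t)) ⟩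
    sumF (λ j → sumF (λ t → A i j * (B j t * v t)))    ≈⟨ sumF-comm (λ j t → A i j * (B j t * v t)) ⟩
    sumF (λ t → sumF (λ j → A i j * (B j t * v t)))    ≈⟨ sumF-cong (λ t → sumF-cong (λ j → *-assoc (A i j) (B j t) (v t))) ⟨
    sumF (λ t → sumF (λ j → A i j * B j t * v t))      ≈⟨ sumF-cong (λ t → sumF-*ʳ (v t) (λ j → A i j * B j t)) ⟨
    sumF (λ t → sumF (λ j → A i j * B j t) * v t)      ∎
    where open import Relation.Binary.Reasoning.Setoid setoid

  module _ {a b} (g : Vect a → Vect b) where
    open CommutativeSemigroupProperties *-commutativeSemigroup using (xy∙z≈xz∙y)

    image⊆span : ∀ x → InSpanImage g (g x)
    image⊆span x = 1 , (λ _ → x) , (λ _ → 1#) , λ j → sym (trans (+-identityʳ _) (*-identityˡ _))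

    InSpanImage-+ : ∀ {u v} → InSpanImage g u → InSpanImage g v → InSpanImage g (λ j → u j + v j)
    InSpanImage-+ (k₁ , p₁ , c₁ , u≋) (k₂ , p₂ , c₂ , v≋) =
      k₁ +ℕ k₂ , p₁ ++ p₂ , c₁ ++ c₂ , λ j → begin
        _ + _                                      ≈⟨ +-cong (u≋ j) (v≋ j) ⟩
        sumF (term j c₁ p₁) + sumF (term j c₂ p₂)  ≈⟨ sumF-++ (term j c₁ p₁) (term j c₂ p₂) ⟨
        sumF (term j c₁ p₁ ++ term j c₂ p₂)        ≈⟨ sumF-cong (λ t → reflexive (zipWith-++ (term′ j) c₁ c₂ p₁ p₂ t)) ⟨
        sumF (term j (c₁ ++ c₂) (p₁ ++ p₂))        ∎
      where
      open import Relation.Binary.Reasoning.Setoid setoid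
      term′ : Fin b → Carrier → Vect a → Carrier
      term′ j c p = c * g p j
      term : ∀ {k} → Fin b → Vect k → (Fin k → Vect a) → Vect k
      term j = zipWith (term′ j)

    InSpanImage-*ʳ : ∀ {u} a → InSpanImage g u → InSpanImage g (λ j → u j * a)
    InSpanImage-*ʳ a (k , p , c , u≋) = k , p , (λ t → c t * a) , λ j →
      trans (*-congʳ (u≋ j))
        (trans (sumF-*ʳ a (λ t → c t * g (p t) j)) (sumF-cong (λ t → xy∙z≈xz∙y (c t) (g (p t) j) a)))

    InSpanImage-linMap : ∀ {k} (U : Matrix b k) → (∀ t → InSpanImage g (λ j → U j t)) →
      ∀ w → InSpanImage g (linMap U w)
    InSpanImage-linMap {nzero} U columns w = 0 , (λ ()) , (λ ()) , λ j → refl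
    InSpanImage-linMap {suc k} U columns w =
      InSpanImage-+ (InSpanImage-*ʳ (w zero) (columns zero))
                    (InSpanImage-linMap (λ j t → U j (suc t)) (columns ∘ suc) (w ∘ suc))

  module _ {a b k} {A : Matrix k b} (g : Vect a → Vect b) (iso : IsoOnSpanImage A g) where
    private
      injective = proj₁ iso
      surjective = proj₂ iso

    -- The t-th column is a preimage in the span of the t-th unit vector.
    section : Matrix b k
    section j t = proj₁ (surjective (1ᴹ t)) j

    A·section≈1ᴹ : ∀ i t → (A ·ᴹ section) i t ≈ 1ᴹ i t
    A·section≈1ᴹ i t = trans (proj₂ (proj₂ (surjective (1ᴹ t))) i) (reflexive (1ᴹ-sym t i))

    section-retracts : ∀ x → g x ≋ linMap section (linMap A (g x))
    section-retracts x =
      injective (g x) (linMap section (linMap A (g x)))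
        (image⊆span g x)
        (InSpanImage-linMap g section (λ t → proj₁ (proj₂ (surjective (1ᴹ t)))) (linMap A (g x)))
        (λ i → sym (A-section-inverse (linMap A (g x)) i))
      where
      A-section-inverse : ∀ w → linMap A (linMap section w) ≋ w
      A-section-inverse w i =
        trans (linMap-·ᴹ A section w i) (trans (linMap-congᴹ A·section≈1ᴹ w i) (linMap-1ᴹ w i))

  module _ {l : ℕ} where
    hpow₀ : ∀ r → HPoly (suc l) r
    hpow₀ nzero   = hconst 1#
    hpow₀ (suc r) = hvar zero h⊗ hpow₀ r

    -- In zero variables there is no homogeneous polynomial of positive degree,
    -- not even 0; this is where l ≥ 1 is needed.
    hzero : ∀ r → HPoly (suc l) r
    hzero r = hconst 0# h⊗ hpow₀ r

    hsum : ∀ {r k} → (Fin k → HPoly (suc l) r) → HPoly (suc l) r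
    hsum {r} {nzero} p = hzero r
    hsum {r} {suc k} p = p zero h⊕ hsum (p ∘ suc)

    heval-hsum : ∀ {r k} (p : Fin k → HPoly (suc l) r) y →
      heval (hsum p) y ≈ sumF (λ t → heval (p t) y)
    heval-hsum {k = nzero} p y = zeroˡ _
    heval-hsum {k = suc k} p y = +-congˡ (heval-hsum (p ∘ suc) y)

    _⊙_ : ∀ {r k b} → Matrix k b → HomPolyMap (suc l) r b → HomPolyMap (suc l) r k
    (A ⊙ Γ) i = hsum (λ j → hconst (A i j) h⊗ Γ j)

    ⟦⊙⟧ : ∀ {r k b} (A : Matrix k b) (Γ : HomPolyMap (suc l) r b) y →
      ⟦ A ⊙ Γ ⟧ₕ y ≋ linMap A (⟦ Γ ⟧ₕ y)
    ⟦⊙⟧ A Γ y i = heval-hsum (λ j → hconst (A i j) h⊗ Γ j) y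

  ImageSub-linMap⇒WeaklyElusive : ∀ {a a′ b b′ l r} {g : Vect a → Vect b} {g′ : Vect a′ → Vect b′}
    (A : Matrix b b′) → ImageSub g (linMap A ∘ g′) →
    WeaklyElusive (suc l) r g → WeaklyElusive (suc l) r g′
  ImageSub-linMap⇒WeaklyElusive {g = g} {g′} A g⊆Ag′ g-elusive (Γ , g′⊆Γ) =
    g-elusive (A ⊙ Γ , g⊆A⊙Γ)
    where
    g⊆A⊙Γ : ImageSub g ⟦ A ⊙ Γ ⟧ₕ
    g⊆A⊙Γ x with g⊆Ag′ x
    ... | x′ , gx≋ with g′⊆Γ x′
    ... | y , g′x′≋ = y , λ i → trans (gx≋ i) (trans (linMap-cong A g′x′≋ i) (sym (⟦⊙⟧ A Γ y i)))

lemma5p2 : ∀ {c ℓ : Level} (F : Field c ℓ) → FieldDefs.CharZero F →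
    ∀ (n m s : ℕ) (f : FieldDefs.PolyMap F n m) →
    FieldDefs.WeaklyElusive F s 1 (FieldDefs.⟦_⟧ F f) →
    ¬ FieldDefs.WeaklyElusive F (suc s) 1 (FieldDefs.⟦_⟧ F f) →
    ∀ (π : FieldDefs.Matrix F (suc s) m) →
    FieldDefs.IsoOnSpanImage F π (FieldDefs.⟦_⟧ F f) →
    ∀ (l r : ℕ) → l ≥ 1 → r ≥ 1 →
    (FieldDefs.WeaklyElusive F l r (FieldDefs.⟦_⟧ F f)
    ⇔ FieldDefs.WeaklyElusive F l r (FieldDefs.linMap F π ∘ FieldDefs.⟦_⟧ F f))
lemma5p2 F _ n m s f _ _ π iso (suc l) r _ _ =
  mk⇔ (ImageSub-linMap⇒WeaklyElusive F (section F ⟦ f ⟧ iso) (λ x → x , section-retracts F ⟦ f ⟧ iso x))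
      (ImageSub-linMap⇒WeaklyElusive F π (λ x → x , λ _ → Field.refl F))
  where open FieldDefs F using (⟦_⟧)
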